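{- Let $f$ be the $n$-ary operation on $\mathbb{Z}_8$ given by $f=2x_1\cdots x_n\left(\sum_{i=1}^n a_ix_i^2+\sum_{i=1}^n b_ix_i+c\right)$ with $a_i,b_i\in\{0,1\}$, $c\in\{0,1,2,3\}$, and assume $a_i\ne0$ for some $i$. Then $2u_n\in C(f)$, where $u_n=x_1\cdots x_n(x_1+1)$.
   Context: For an operation $g$ on $\mathbb{Z}_8$, $C(g)$ denotes the clone on $\mathbb{Z}_8$ generated by $g$, the binary addition and all unary constant operations. -}

module Defs where

open import Data.Nat using (ℕ; zero; suc; _+_; _*_)
open import Data.Nat.DivMod using (_mod_)
open import Data.Fin using (Fin; toℕ) renaming (zero to fzero; suc to fsuc)
open import Data.Product using (Σ)
open import Relation.Binary.PropositionalEquality using (_≡_)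

ℤ₈ : Set
ℤ₈ = Fin 8

ι : ℕ → ℤ₈
ι k = k mod 8

_⊕_ : ℤ₈ → ℤ₈ → ℤ₈
x ⊕ y = ι (toℕ x + toℕ y)

_⊗_ : ℤ₈ → ℤ₈ → ℤ₈
x ⊗ y = ι (toℕ x * toℕ y)

infixl 6 _⊕_
infixl 7 _⊗_

Op : ℕ → Set
Op n = (Fin n → ℤ₈) → ℤ₈

Σ₈ : (n : ℕ) → (Fin n → ℤ₈) → ℤ₈
Σ₈ zero    v = ι 0
Σ₈ (suc n) v = v fzero ⊕ Σ₈ n (λ i → v (fsuc i))

Π₈ : (n : ℕ) → (Fin n → ℤ₈) → ℤ₈
Π₈ zero    v = ι 1
Π₈ (suc n) v = v fzero ⊗ Π₈ n (λ i → v (fsuc i))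

data Term {m : ℕ} (g : Op m) (k : ℕ) : Set where
  var   : Fin k → Term g k
  const : ℤ₈ → Term g k
  add   : Term g k → Term g k → Term g k
  app   : (Fin m → Term g k) → Term g k

⟦_⟧ : {m : ℕ} {g : Op m} {k : ℕ} → Term g k → Op k
⟦_⟧         (var i)   x = x i
⟦_⟧         (const c) x = c
⟦_⟧         (add s t) x = ⟦ s ⟧ x ⊕ ⟦ t ⟧ x
⟦_⟧ {g = g} (app ts)  x = g (λ j → ⟦ ts j ⟧ x)

-- C(g): the clone on ℤ₈ generated by g, + and all unary constants,
-- i.e. the set of operations (of any arity k) that are term operations.
_∈C_ : {m k : ℕ} → Op k → Op m → Set
_∈C_ {m} {k} h g = Σ (Term g k) (λ t → (x : Fin k → ℤ₈) → ⟦ t ⟧ x ≡ h x)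

fOp : (n : ℕ) → (Fin n → Fin 2) → (Fin n → Fin 2) → Fin 4 → Op n
fOp n a b c x =
  ι 2 ⊗ Π₈ n x ⊗
    (Σ₈ n (λ i → ι (toℕ (a i)) ⊗ x i ⊗ x i)
      ⊕ Σ₈ n (λ i → ι (toℕ (b i)) ⊗ x i)
      ⊕ ι (toℕ c))

-- 2uₙ where uₙ = x₁⋯xₙ(x₁ + 1); arity n = suc m (x₁ must exist)
twoU : (m : ℕ) → Op (suc m)
twoU m x = ι 2 ⊗ (Π₈ (suc m) x ⊗ (x fzero ⊕ ι 1))

{-# OPTIONS --safe #-}
module Submission where

-- Choose i with aᵢ = 1 and exchange x₁ with xᵢ. As a function of the value y
-- put in slot i, f becomes φ(y) = 2yR(y² + bᵢy + s), where R and s depend only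
-- on the remaining variables and x₁R = x₁⋯xₙ. The term operation
--   φ(y) − φ(y + 1) + φ(1) + bᵢ(φ(y) + φ(−y))
-- equals 2R(−3y² − 3y + 2bᵢ(y² − y)): the constant, the cubic and the s-terms
-- cancel. Modulo 8 the bracket only matters modulo 4, where it is y² + y because
-- y² − y is even; so at y = x₁ the combination is 2x₁⋯xₙ(x₁ + 1) = 2uₙ.

open import Defs
open import Algebra.Bundles using (CommutativeMonoid)
open import Algebra.Structures.Biased using (isCommutativeMonoidˡ)
open import Data.Fin using (Fin; toℕ) renaming (zero to fzero; suc to fsuc)
import Data.Fin
open import Data.Fin.Properties using (all?; _≟_)
open import Data.Nat using (ℕ; zero; suc)
open import Data.Product using (∃; _,_; proj₁; proj₂)
open import Data.Vec.Functional using (Vector; tail; updateAt)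
open import Data.Vec.Functional.Properties using (updateAt-id-local)
open import Function using (_∘_)
open import Level using (0ℓ)
open import Relation.Binary.PropositionalEquality
open import Relation.Binary.PropositionalEquality.Algebra using (isMagma)
open import Relation.Nullary.Decidable using (True; toWitness)
open ≡-Reasoning

private
  variable
    k m n : ℕ
    g : Op m
    h h′ Y : Op k

decide₁ : (F G : ℤ₈ → ℤ₈) → {True (all? λ x → F x ≟ G x)} → ∀ x → F x ≡ G x
decide₁ F G {p} = toWitness p

decide₂ : (F G : ℤ₈ → ℤ₈ → ℤ₈) →
  {True (all? λ x → all? λ y → F x y ≟ G x y)} → ∀ x y → F x y ≡ G x y
decide₂ F G {p} = toWitness p

decide₃ : (F G : ℤ₈ → ℤ₈ → ℤ₈ → ℤ₈) →
  {True (all? λ x → all? λ y → all? λ z → F x y z ≟ G x y z)} →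
  ∀ x y z → F x y z ≡ G x y z
decide₃ F G {p} = toWitness p

⊕-commutativeMonoid : CommutativeMonoid 0ℓ 0ℓ
⊕-commutativeMonoid = record
  { Carrier             = ℤ₈
  ; _≈_                 = _≡_
  ; _∙_                 = _⊕_
  ; ε                   = ι 0
  ; isCommutativeMonoid = isCommutativeMonoidˡ record
    { isSemigroup = record
      { isMagma = isMagma _⊕_
      ; assoc   = decide₃ (λ x y z → x ⊕ y ⊕ z) (λ x y z → x ⊕ (y ⊕ z))
      }
    ; identityˡ = decide₁ (ι 0 ⊕_) (λ x → x)
    ; comm      = decide₂ _⊕_ (λ x y → y ⊕ x)
    }
  }

⊗-commutativeMonoid : CommutativeMonoid 0ℓ 0ℓ
⊗-commutativeMonoid = record
  { Carrier             = ℤ₈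
  ; _≈_                 = _≡_
  ; _∙_                 = _⊗_
  ; ε                   = ι 1
  ; isCommutativeMonoid = isCommutativeMonoidˡ record
    { isSemigroup = record
      { isMagma = isMagma _⊗_
      ; assoc   = decide₃ (λ x y z → x ⊗ y ⊗ z) (λ x y z → x ⊗ (y ⊗ z))
      }
    ; identityˡ = decide₁ (ι 1 ⊗_) (λ x → x)
    ; comm      = decide₂ _⊗_ (λ x y → y ⊗ x)
    }
  }

open CommutativeMonoid ⊕-commutativeMonoid
  using () renaming (assoc to ⊕-assoc; identityˡ to ⊕-identityˡ)
open CommutativeMonoid ⊗-commutativeMonoid
  using () renaming (identityˡ to ⊗-identityˡ)
open import Algebra.Properties.CommutativeSemigroup
  (CommutativeMonoid.commutativeSemigroup ⊕-commutativeMonoid)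
  using () renaming (interchange to ⊕-interchange; x∙yz≈y∙xz to ⊕-exchange)
open import Algebra.Properties.CommutativeSemigroup
  (CommutativeMonoid.commutativeSemigroup ⊗-commutativeMonoid)
  using () renaming (x∙yz≈y∙xz to ⊗-exchange)
open import Algebra.Definitions.RawMonoid
  (CommutativeMonoid.rawMonoid ⊕-commutativeMonoid) using (_×_)

⊗-zeroʳ : ∀ x → x ⊗ ι 0 ≡ ι 0
⊗-zeroʳ = decide₁ (_⊗ ι 0) (λ _ → ι 0)

_[_]≔_ : {A : Set} → Vector A n → Fin n → A → Vector A n
v [ i ]≔ y = updateAt v i (λ _ → y)

Σ₈-cong : ∀ n {u v : Fin n → ℤ₈} → u ≗ v → Σ₈ n u ≡ Σ₈ n v
Σ₈-cong zero    u≗v = refl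
Σ₈-cong (suc n) u≗v = cong₂ _⊕_ (u≗v fzero) (Σ₈-cong n (u≗v ∘ fsuc))

Π₈-cong : ∀ n {u v : Fin n → ℤ₈} → u ≗ v → Π₈ n u ≡ Π₈ n v
Π₈-cong zero    u≗v = refl
Π₈-cong (suc n) u≗v = cong₂ _⊗_ (u≗v fzero) (Π₈-cong n (u≗v ∘ fsuc))

Π₈-[]≔ : ∀ n (v : Fin n → ℤ₈) i y → Π₈ n (v [ i ]≔ y) ≡ y ⊗ Π₈ n (v [ i ]≔ ι 1)
Π₈-[]≔ (suc n) v fzero    y = cong (y ⊗_) (sym (⊗-identityˡ _))
Π₈-[]≔ (suc n) v (fsuc i) y = trans (cong (v fzero ⊗_) (Π₈-[]≔ n (tail v) i y))
                                    (⊗-exchange (v fzero) y _)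

Σ₈-[]≔ : ∀ n (t : Fin n → ℤ₈ → ℤ₈) → (∀ i → t i (ι 0) ≡ ι 0) →
  ∀ (v : Fin n → ℤ₈) i y →
  Σ₈ n (λ j → t j ((v [ i ]≔ y) j)) ≡ t i y ⊕ Σ₈ n (λ j → t j ((v [ i ]≔ ι 0) j))
Σ₈-[]≔ (suc n) t t[0]≡0 v fzero    y =
  cong (t fzero y ⊕_) (sym (trans (cong (_⊕ rest) (t[0]≡0 fzero)) (⊕-identityˡ rest)))
  where
  rest : ℤ₈
  rest = Σ₈ n (λ j → t (fsuc j) (v (fsuc j)))
Σ₈-[]≔ (suc n) t t[0]≡0 v (fsuc i) y =
  trans (cong (t fzero (v fzero) ⊕_) (Σ₈-[]≔ n (t ∘ fsuc) (t[0]≡0 ∘ fsuc) (tail v) i y))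
        (⊕-exchange (t fzero (v fzero)) (t (fsuc i) y) _)

Π₈-swap : ∀ n (x : Fin (suc n) → ℤ₈) i →
  Π₈ (suc n) ((x [ fzero ]≔ x i) [ i ]≔ x fzero) ≡ Π₈ (suc n) x
Π₈-swap n x fzero    = refl
Π₈-swap n x (fsuc i) = begin
  x (fsuc i) ⊗ Π₈ n (tail x [ i ]≔ x fzero)            ≡⟨ cong (x (fsuc i) ⊗_) (Π₈-[]≔ n (tail x) i (x fzero)) ⟩
  x (fsuc i) ⊗ (x fzero ⊗ Π₈ n (tail x [ i ]≔ ι 1))    ≡⟨ ⊗-exchange (x (fsuc i)) (x fzero) _ ⟩
  x fzero ⊗ (x (fsuc i) ⊗ Π₈ n (tail x [ i ]≔ ι 1))    ≡⟨ cong (x fzero ⊗_) (Π₈-[]≔ n (tail x) i (x (fsuc i))) ⟨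
  x fzero ⊗ Π₈ n (tail x [ i ]≔ x (fsuc i))            ≡⟨ cong (x fzero ⊗_) (Π₈-cong n (updateAt-id-local i (tail x) refl)) ⟩
  x fzero ⊗ Π₈ n (tail x)                               ∎

Extensional : Op m → Set
Extensional {m} g = {u v : Fin m → ℤ₈} → u ≗ v → g u ≡ g v

∈C-resp : h ≗ h′ → h ∈C g → h′ ∈C g
∈C-resp h≗h′ (t , ⟦t⟧≗h) = t , λ x → trans (⟦t⟧≗h x) (h≗h′ x)

var-∈C : (i : Fin k) → (λ x → x i) ∈C g
var-∈C i = var i , λ _ → refl

const-∈C : (c : ℤ₈) → (λ (x : Fin k → ℤ₈) → c) ∈C g
const-∈C c = const c , λ _ → refl

⊕-∈C : h ∈C g → h′ ∈C g → (λ x → h x ⊕ h′ x) ∈C g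
⊕-∈C (s , ⟦s⟧≗h) (t , ⟦t⟧≗h′) = add s t , λ x → cong₂ _⊕_ (⟦s⟧≗h x) (⟦t⟧≗h′ x)

×-∈C : ∀ j → h ∈C g → (λ x → j × h x) ∈C g
×-∈C zero    h∈C = const-∈C (ι 0)
×-∈C (suc j) h∈C = ⊕-∈C h∈C (×-∈C j h∈C)

app-∈C : Extensional g → (hs : Fin m → Op k) → (∀ j → hs j ∈C g) →
  (λ x → g (λ j → hs j x)) ∈C g
app-∈C g-ext hs hs∈C = app (proj₁ ∘ hs∈C) , λ x → g-ext (λ j → proj₂ (hs∈C j) x)

[]≔-∈C : {v : (Fin k → ℤ₈) → Fin n → ℤ₈} → (∀ j → (λ x → v x j) ∈C g) → Y ∈C g →
  ∀ i j → (λ x → (v x [ i ]≔ Y x) j) ∈C g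
[]≔-∈C v∈C Y∈C fzero    fzero    = Y∈C
[]≔-∈C v∈C Y∈C fzero    (fsuc j) = v∈C (fsuc j)
[]≔-∈C v∈C Y∈C (fsuc i) fzero    = v∈C fzero
[]≔-∈C {v = v} v∈C Y∈C (fsuc i) (fsuc j) =
  []≔-∈C {v = tail ∘ v} (v∈C ∘ fsuc) Y∈C i j

Δ : ℕ → (ℤ₈ → ℤ₈) → ℤ₈ → ℤ₈
Δ β φ y = φ y ⊕ 7 × φ (y ⊕ ι 1) ⊕ φ (ι 1) ⊕ β × (φ y ⊕ φ (7 × y))

Δ-cong : ∀ β {φ ψ : ℤ₈ → ℤ₈} → φ ≗ ψ → ∀ y → Δ β φ y ≡ Δ β ψ y
Δ-cong β φ≗ψ y =
  cong₂ _⊕_ (cong₂ _⊕_ (cong₂ _⊕_ (φ≗ψ y) (cong (7 ×_) (φ≗ψ _))) (φ≗ψ _))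
            (cong (β ×_) (cong₂ _⊕_ (φ≗ψ y) (φ≗ψ _)))

Δ-∈C : ∀ β {φ : (Fin k → ℤ₈) → ℤ₈ → ℤ₈} →
  (∀ {Y} → Y ∈C g → (λ x → φ x (Y x)) ∈C g) → Y ∈C g → (λ x → Δ β (φ x) (Y x)) ∈C g
Δ-∈C β φ∈C Y∈C =
  ⊕-∈C (⊕-∈C (⊕-∈C (φ∈C Y∈C) (×-∈C 7 (φ∈C (⊕-∈C Y∈C (const-∈C (ι 1))))))
              (φ∈C (const-∈C (ι 1))))
       (×-∈C β (⊕-∈C (φ∈C Y∈C) (φ∈C (×-∈C 7 Y∈C))))

slice : (α β : Fin 2) (R s y : ℤ₈) → ℤ₈
slice α β R s y = ι 2 ⊗ (y ⊗ R) ⊗ ((ι (toℕ α) ⊗ y ⊗ y ⊕ ι (toℕ β) ⊗ y) ⊕ s)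

Δ-slice : ∀ β R s y → Δ (toℕ β) (slice (fsuc fzero) β R s) y ≡ ι 2 ⊗ ((y ⊗ R) ⊗ (y ⊕ ι 1))
Δ-slice fzero        = decide₃ (λ R s → Δ 0 (slice (fsuc fzero) fzero R s))
                               (λ R s y → ι 2 ⊗ ((y ⊗ R) ⊗ (y ⊕ ι 1)))
Δ-slice (fsuc fzero) = decide₃ (λ R s → Δ 1 (slice (fsuc fzero) (fsuc fzero) R s))
                               (λ R s y → ι 2 ⊗ ((y ⊗ R) ⊗ (y ⊕ ι 1)))

fQuadratic : (n : ℕ) → (Fin n → Fin 2) → (Fin n → Fin 2) → Fin 4 → Op n
fQuadratic n a b c x =
  Σ₈ n (λ i → ι (toℕ (a i)) ⊗ x i ⊗ x i) ⊕ Σ₈ n (λ i → ι (toℕ (b i)) ⊗ x i) ⊕ ι (toℕ c)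

module _ (n : ℕ) (a b : Fin n → Fin 2) (c : Fin 4) where

  fOp-cong : Extensional (fOp n a b c)
  fOp-cong u≗v =
    cong₂ (λ p q → ι 2 ⊗ p ⊗ q) (Π₈-cong n u≗v)
      (cong₂ (λ p q → p ⊕ q ⊕ ι (toℕ c))
        (Σ₈-cong n (λ i → cong (λ t → ι (toℕ (a i)) ⊗ t ⊗ t) (u≗v i)))
        (Σ₈-cong n (λ i → cong (ι (toℕ (b i)) ⊗_) (u≗v i))))

  fQuadratic-[]≔ : ∀ (w : Fin n → ℤ₈) i y →
    fQuadratic n a b c (w [ i ]≔ y) ≡
      (ι (toℕ (a i)) ⊗ y ⊗ y ⊕ ι (toℕ (b i)) ⊗ y) ⊕ fQuadratic n a b c (w [ i ]≔ ι 0)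
  fQuadratic-[]≔ w i y = begin
    fQuadratic n a b c (w [ i ]≔ y)
      ≡⟨ cong₂ (λ p q → p ⊕ q ⊕ ι (toℕ c))
           (Σ₈-[]≔ n (λ j u → ι (toℕ (a j)) ⊗ u ⊗ u) (λ j → ⊗-zeroʳ (ι (toℕ (a j)) ⊗ ι 0)) w i y)
           (Σ₈-[]≔ n (λ j u → ι (toℕ (b j)) ⊗ u) (λ j → ⊗-zeroʳ (ι (toℕ (b j)))) w i y) ⟩
    (A ⊕ A₀) ⊕ (B ⊕ B₀) ⊕ C  ≡⟨ cong (_⊕ C) (⊕-interchange A A₀ B B₀) ⟩
    (A ⊕ B) ⊕ (A₀ ⊕ B₀) ⊕ C  ≡⟨ ⊕-assoc (A ⊕ B) (A₀ ⊕ B₀) C ⟩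
    (A ⊕ B) ⊕ (A₀ ⊕ B₀ ⊕ C)  ∎
    where
    A B A₀ B₀ C : ℤ₈
    A  = ι (toℕ (a i)) ⊗ y ⊗ y
    B  = ι (toℕ (b i)) ⊗ y
    A₀ = Σ₈ n (λ j → ι (toℕ (a j)) ⊗ (w [ i ]≔ ι 0) j ⊗ (w [ i ]≔ ι 0) j)
    B₀ = Σ₈ n (λ j → ι (toℕ (b j)) ⊗ (w [ i ]≔ ι 0) j)
    C  = ι (toℕ c)

  fOp-[]≔ : ∀ (w : Fin n → ℤ₈) i y →
    fOp n a b c (w [ i ]≔ y) ≡
      slice (a i) (b i) (Π₈ n (w [ i ]≔ ι 1)) (fQuadratic n a b c (w [ i ]≔ ι 0)) y
  fOp-[]≔ w i y = cong₂ (λ p q → ι 2 ⊗ p ⊗ q) (Π₈-[]≔ n w i y) (fQuadratic-[]≔ w i y)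

lemma4p3 : (m : ℕ) (a b : Fin (suc m) → Fin 2) (c : Fin 4) →
    ∃ (λ i → a i ≡ Data.Fin.suc Data.Fin.zero) →
    twoU m ∈C fOp (suc m) a b c
lemma4p3 m a b c (i , aᵢ≡1) =
  ∈C-resp Δ≗twoU (Δ-∈C (toℕ (b i)) {φ = φ} φ-∈C (var-∈C fzero))
  where
  f : Op (suc m)
  f = fOp (suc m) a b c

  φ : (Fin (suc m) → ℤ₈) → ℤ₈ → ℤ₈
  φ x y = f ((x [ fzero ]≔ x i) [ i ]≔ y)

  φ-∈C : Y ∈C f → (λ x → φ x (Y x)) ∈C f
  φ-∈C Y∈C = app-∈C (fOp-cong (suc m) a b c) _
    ([]≔-∈C {v = λ x → x [ fzero ]≔ x i} ([]≔-∈C {v = λ x → x} var-∈C (var-∈C i) fzero) Y∈C i)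

  Δ≗twoU : ∀ x → Δ (toℕ (b i)) (φ x) (x fzero) ≡ twoU m x
  Δ≗twoU x = begin
    Δ (toℕ (b i)) (φ x) (x fzero)
      ≡⟨ Δ-cong (toℕ (b i)) (λ y → trans (fOp-[]≔ (suc m) a b c w i y)
                                         (cong (λ α → slice α (b i) R s y) aᵢ≡1)) (x fzero) ⟩
    Δ (toℕ (b i)) (slice (fsuc fzero) (b i) R s) (x fzero)  ≡⟨ Δ-slice (b i) R s (x fzero) ⟩
    ι 2 ⊗ ((x fzero ⊗ R) ⊗ (x fzero ⊕ ι 1))
      ≡⟨ cong (λ p → ι 2 ⊗ (p ⊗ (x fzero ⊕ ι 1)))
              (trans (sym (Π₈-[]≔ (suc m) w i (x fzero))) (Π₈-swap m x i)) ⟩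
    twoU m x  ∎
    where
    w : Fin (suc m) → ℤ₈
    w = x [ fzero ]≔ x i
    R s : ℤ₈
    R = Π₈ (suc m) (w [ i ]≔ ι 1)
    s = fQuadratic (suc m) a b c (w [ i ]≔ ι 0)
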